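{- Let $\mathcal{R}$ and $\mathcal{R}'$ be two recommendations for $K$ taxicabs (in the sense of the context) which differ only in their $q$-th route: the $q$-th route of $\mathcal{R}$ is $(c_1,\dots,c_{l-1})$ and the $q$-th route of $\mathcal{R}'$ is $(c_1,\dots,c_{l})$ for some $l\ge 1$, all other routes being identical; write $c_0=0$. Let $t_{\mathrm{end}}$ be the arrival time of taxicab $q$ at $c_l$ under $\mathcal{R}'$, and assume that for every $k\neq q$ and every index $u$ with $c_{k,u}=c_l$ one has $t_{k,u}<t_{\mathrm{end}}$, or $t_{k,u}=t_{\mathrm{end}}$ and $k<q$. Then for every outcome $\mathbf{u}=(u_1,\dots,u_K)$ of $\mathcal{R}'$, $$s_{\mathcal{R}'}(\mathbf{u})=\begin{cases} s_{\mathcal{R}}(\mathbf{u}), & 0<u_q<l,\\ s_{\mathcal{R}}(\mathbf{u})-\mathit{Penalty}+T(c_{l-1},c_l), & u_q=l,\\ s_{\mathcal{R}}(\mathbf{u}-\mathbf{i}_q)+T(c_{l-1},c_l), & u_q=l+1,\end{cases}$$ where $\mathbf{i}_q$ is the vector whose entries are all $0$ except the $q$-th, which is $1$.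
   Context: Setting. There is a set of pick-up points $\mathcal{C}=\{1,\dots,N\}$ and an initial position $0$. $T(c,c')\ge 0$ is the travel time between points $c,c'\in\mathcal{C}\cup\{0\}$, and $\mathit{Penalty}\ge 0$ is a fixed penalty time. A recommendation $\mathcal{R}=(\overrightarrow{R_1},\dots,\overrightarrow{R_K})$ is an ordered $K$-tuple of routes; route $\overrightarrow{R_k}=(c_{k,1},\dots,c_{k,l_k})$ is a sequence of $l_k\ge 0$ pairwise distinct points of $\mathcal{C}$; set $c_{k,0}=0$. All taxicabs start at $0$ at time $0$; the arrival time of taxicab $k$ at its $u$-th point is $t_{k,u}=\sum_{j=1}^{u}T(c_{k,j-1},c_{k,j})$ (so $t_{k,0}=0$). An outcome is $\mathbf{u}=(u_1,\dots,u_K)$ with $1\le u_k\le l_k+1$: taxicab $k$ picks up a passenger at its $u_k$-th point, or, if $u_k=l_k+1$, picks up nobody along its route. Total cruising time of an outcome: $s_{\mathcal{R}}(\mathbf{u})=\sum_{k=1}^K\bigl(t_{k,u_k}\,\mathbb{I}_{u_k\le l_k}+(t_{k,l_k}+\mathit{Penalty})\,\mathbb{I}_{u_k=l_k+1}\bigr)$, i.e. each taxicab contributes its travel time up to its pick-up point, or its full route travel time plus $\mathit{Penalty}$ if it picks up nobody.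
   Formalization: The travel times $T(c,c')$ and the penalty time $\mathit{Penalty}$ are rational. -}

module Defs where

open import Data.Nat using (ℕ; zero; suc; _∸_; _≤?_)
open import Data.Fin using (Fin; _≟_) renaming (zero to fzero; suc to fsuc)
open import Data.List using (List; []; _∷_; length)
open import Data.Rational using (ℚ; 0ℚ; _+_)
open import Relation.Nullary using (yes; no)

-- Points: Fin (suc N); fzero is the initial position 0, fsuc c is pick-up point c ∈ 𝒞.
Point : ℕ → Set
Point N = Fin (suc N)

Route : ℕ → Set
Route N = List (Fin N)

Recommendation : ℕ → ℕ → Set
Recommendation N K = Fin K → Route N

-- arrival time t_u along a route, starting from point p (u counts points visited;
-- meaningful for u ≤ length of the route).
arrFrom : ∀ {N} → (Point N → Point N → ℚ) → Point N → Route N → ℕ → ℚ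
arrFrom T p xs       zero    = 0ℚ
arrFrom T p []       (suc u) = 0ℚ
arrFrom T p (c ∷ cs) (suc u) = T p (fsuc c) + arrFrom T (fsuc c) cs u

arrival : ∀ {N} → (Point N → Point N → ℚ) → Route N → ℕ → ℚ
arrival T r u = arrFrom T fzero r u

lastPoint : ∀ {N} → Route N → Point N
lastPoint []           = fzero
lastPoint (c ∷ [])     = fsuc c
lastPoint (c ∷ d ∷ cs) = lastPoint (d ∷ cs)

-- contribution of one taxicab with outcome index u (1 ≤ u ≤ l+1)
contribution : ∀ {N} → (Point N → Point N → ℚ) → ℚ → Route N → ℕ → ℚ
contribution T P r u with u ≤? length r
... | yes _ = arrival T r u
... | no  _ = arrival T r (length r) + P

sumFin : ∀ {K} → (Fin K → ℚ) → ℚ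
sumFin {zero}  f = 0ℚ
sumFin {suc K} f = f fzero + sumFin (λ i → f (fsuc i))

cruising : ∀ {N K} → (Point N → Point N → ℚ) → ℚ → Recommendation N K → (Fin K → ℕ) → ℚ
cruising T P R u = sumFin (λ k → contribution T P (R k) (u k))

decAt : ∀ {K} → Fin K → (Fin K → ℕ) → (Fin K → ℕ)
decAt q u k with k ≟ q
... | yes _ = u k ∸ 1
... | no  _ = u k

module Submission where

open import Defs
open import Data.Nat using (ℕ; zero; suc; _≤_; _∸_; _≤?_; s≤s) renaming (_<_ to _<ℕ_)
open import Data.Nat.Properties using (≤-reflexive; m≤n⇒m≤1+n; <⇒≱; n<1+n)
open import Data.Fin using (Fin; toℕ; _≟_) renaming (zero to fzero; suc to fsuc)
open import Data.Fin.Properties using (suc-injective)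
open import Data.List using (List; []; _∷_; length; lookup; _++_; [_])
open import Data.List.Relation.Unary.Unique.Propositional using (Unique)
open import Data.Rational using (ℚ; 0ℚ; _+_; _-_) renaming (_≤_ to _≤ℚ_; _<_ to _<ℚ_)
open import Data.Rational.Properties using (+-identityʳ)
open import Data.Rational.Solver using (module +-*-Solver)
open import Data.Product using (_×_; _,_)
open import Data.Sum using (_⊎_)
open import Data.Empty using (⊥-elim)
open import Relation.Nullary using (yes; no)
open import Relation.Binary.PropositionalEquality
  using (_≡_; _≢_; refl; sym; trans; cong; cong₂; subst; subst₂; module ≡-Reasoning)

open +-*-Solver using (solve; con; _:=_; _:+_; _:-_)
open ≡-Reasoning

-- The route (c₁,…,c_{l-1}) and its extension (c₁,…,c_l) produce the same
-- contribution as long as the taxicab stops at one of c₁,…,c_{l-1}.  Stopping at c_l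
-- replaces the penalty by the last leg T(c_{l-1},c_l), and picking up nobody costs
-- that extra leg on top of "picking up nobody" on the short route.  All other
-- taxicabs contribute identically, so the totals differ by the same amount.

length-∷ʳ : ∀ {A : Set} (xs : List A) (x : A) → length (xs ++ [ x ]) ≡ suc (length xs)
length-∷ʳ []       x = refl
length-∷ʳ (_ ∷ xs) x = cong suc (length-∷ʳ xs x)

module _ {N : ℕ} (T : Point N → Point N → ℚ) where

  lastFrom : Point N → Route N → Point N
  lastFrom p []       = p
  lastFrom p (c ∷ cs) = lastFrom (fsuc c) cs

  lastFrom-∷ : ∀ p c cs → lastFrom p (c ∷ cs) ≡ lastPoint (c ∷ cs)
  lastFrom-∷ p c []       = refl
  lastFrom-∷ p c (d ∷ cs) = lastFrom-∷ (fsuc c) d cs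

  lastFrom-fzero : ∀ cs → lastFrom fzero cs ≡ lastPoint cs
  lastFrom-fzero []       = refl
  lastFrom-fzero (c ∷ cs) = lastFrom-∷ fzero c cs

  arrFrom-∷ʳ-≤ : ∀ p cs cl u → u ≤ length cs → arrFrom T p (cs ++ [ cl ]) u ≡ arrFrom T p cs u
  arrFrom-∷ʳ-≤ p cs       cl zero    _       = refl
  arrFrom-∷ʳ-≤ p (c ∷ cs) cl (suc u) (s≤s h) = cong (T p (fsuc c) +_) (arrFrom-∷ʳ-≤ (fsuc c) cs cl u h)

  arrFrom-∷ʳ-last : ∀ p cs cl → arrFrom T p (cs ++ [ cl ]) (suc (length cs))
                                ≡ arrFrom T p cs (length cs) + T (lastFrom p cs) (fsuc cl)
  arrFrom-∷ʳ-last p []       cl = solve 1 (λ t → t :+ con 0ℚ := con 0ℚ :+ t) refl (T p (fsuc cl))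
  arrFrom-∷ʳ-last p (c ∷ cs) cl =
    trans (cong (T p (fsuc c) +_) (arrFrom-∷ʳ-last (fsuc c) cs cl))
          (solve 3 (λ a b t → a :+ (b :+ t) := (a :+ b) :+ t) refl
                 (T p (fsuc c)) (arrFrom T (fsuc c) cs (length cs)) (T (lastFrom (fsuc c) cs) (fsuc cl)))

  arrival-∷ʳ-last : ∀ cs cl → arrival T (cs ++ [ cl ]) (suc (length cs))
                              ≡ arrival T cs (length cs) + T (lastPoint cs) (fsuc cl)
  arrival-∷ʳ-last cs cl =
    trans (arrFrom-∷ʳ-last fzero cs cl)
          (cong (λ p → arrival T cs (length cs) + T p (fsuc cl)) (lastFrom-fzero cs))

  module _ (P : ℚ) where

    contribution-≤ : ∀ r u → u ≤ length r → contribution T P r u ≡ arrival T r u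
    contribution-≤ r u h with u ≤? length r
    ... | yes _ = refl
    ... | no ¬h = ⊥-elim (¬h h)

    contribution-> : ∀ r u → length r <ℕ u → contribution T P r u ≡ arrival T r (length r) + P
    contribution-> r u h with u ≤? length r
    ... | yes u≤l = ⊥-elim (<⇒≱ h u≤l)
    ... | no _    = refl

    contribution-∷ʳ-≤ : ∀ cs cl u → u ≤ length cs
                        → contribution T P (cs ++ [ cl ]) u ≡ contribution T P cs u
    contribution-∷ʳ-≤ cs cl u h = begin
      contribution T P (cs ++ [ cl ]) u  ≡⟨ contribution-≤ (cs ++ [ cl ]) u u≤l+1 ⟩
      arrival T (cs ++ [ cl ]) u         ≡⟨ arrFrom-∷ʳ-≤ fzero cs cl u h ⟩
      arrival T cs u                     ≡⟨ contribution-≤ cs u h ⟨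
      contribution T P cs u              ∎
      where
      u≤l+1 : u ≤ length (cs ++ [ cl ])
      u≤l+1 = subst (u ≤_) (sym (length-∷ʳ cs cl)) (m≤n⇒m≤1+n h)

    contribution-∷ʳ-last : ∀ cs cl →
      contribution T P (cs ++ [ cl ]) (suc (length cs))
        ≡ contribution T P cs (suc (length cs)) + (T (lastPoint cs) (fsuc cl) - P)
    contribution-∷ʳ-last cs cl = begin
      contribution T P (cs ++ [ cl ]) (suc L)  ≡⟨ contribution-≤ (cs ++ [ cl ]) (suc L) l+1≤l+1 ⟩
      arrival T (cs ++ [ cl ]) (suc L)         ≡⟨ arrival-∷ʳ-last cs cl ⟩
      a + t                                    ≡⟨ solve 3 (λ a t P → a :+ t := (a :+ P) :+ (t :- P)) refl a t P ⟩
      (a + P) + (t - P)                        ≡⟨ cong (_+ (t - P)) (contribution-> cs (suc L) (n<1+n L)) ⟨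
      contribution T P cs (suc L) + (t - P)    ∎
      where
      L = length cs
      a = arrival T cs L
      t = T (lastPoint cs) (fsuc cl)
      l+1≤l+1 : suc L ≤ length (cs ++ [ cl ])
      l+1≤l+1 = ≤-reflexive (sym (length-∷ʳ cs cl))

    contribution-∷ʳ-beyond : ∀ cs cl →
      contribution T P (cs ++ [ cl ]) (suc (suc (length cs)))
        ≡ contribution T P cs (suc (length cs)) + T (lastPoint cs) (fsuc cl)
    contribution-∷ʳ-beyond cs cl = begin
      contribution T P (cs ++ [ cl ]) (suc (suc L))
        ≡⟨ contribution-> (cs ++ [ cl ]) (suc (suc L)) l+1<l+2 ⟩
      arrival T (cs ++ [ cl ]) (length (cs ++ [ cl ])) + P
        ≡⟨ cong (λ n → arrival T (cs ++ [ cl ]) n + P) (length-∷ʳ cs cl) ⟩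
      arrival T (cs ++ [ cl ]) (suc L) + P
        ≡⟨ cong (_+ P) (arrival-∷ʳ-last cs cl) ⟩
      (a + t) + P
        ≡⟨ solve 3 (λ a t P → (a :+ t) :+ P := (a :+ P) :+ t) refl a t P ⟩
      (a + P) + t
        ≡⟨ cong (_+ t) (contribution-> cs (suc L) (n<1+n L)) ⟨
      contribution T P cs (suc L) + t ∎
      where
      L = length cs
      a = arrival T cs L
      t = T (lastPoint cs) (fsuc cl)
      l+1<l+2 : length (cs ++ [ cl ]) <ℕ suc (suc L)
      l+1<l+2 = subst (_<ℕ suc (suc L)) (sym (length-∷ʳ cs cl)) (n<1+n (suc L))

sumFin-cong : ∀ {K} (f g : Fin K → ℚ) → (∀ k → f k ≡ g k) → sumFin f ≡ sumFin g
sumFin-cong {zero}  f g f≗g = refl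
sumFin-cong {suc K} f g f≗g =
  cong₂ _+_ (f≗g fzero) (sumFin-cong (λ i → f (fsuc i)) (λ i → g (fsuc i)) (λ i → f≗g (fsuc i)))

sumFin-update : ∀ {K} (f g : Fin K → ℚ) (q : Fin K) (d : ℚ)
  → (∀ k → k ≢ q → f k ≡ g k) → f q ≡ g q + d → sumFin f ≡ sumFin g + d
sumFin-update {suc K} f g fzero d f≗g fq = begin
  f fzero + sumFin (λ i → f (fsuc i))  ≡⟨ cong₂ _+_ fq (sumFin-cong _ _ (λ i → f≗g (fsuc i) λ ())) ⟩
  (g fzero + d) + S                    ≡⟨ solve 3 (λ x d S → (x :+ d) :+ S := (x :+ S) :+ d) refl (g fzero) d S ⟩
  (g fzero + S) + d                    ∎
  where S = sumFin (λ i → g (fsuc i))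
sumFin-update {suc K} f g (fsuc q) d f≗g fq = begin
  f fzero + sumFin (λ i → f (fsuc i))  ≡⟨ cong₂ _+_ (f≗g fzero λ ()) (sumFin-update _ _ q d tail-≗ fq) ⟩
  g fzero + (S + d)                    ≡⟨ solve 3 (λ x S d → x :+ (S :+ d) := (x :+ S) :+ d) refl (g fzero) S d ⟩
  (g fzero + S) + d                    ∎
  where
  S = sumFin (λ i → g (fsuc i))
  tail-≗ : ∀ k → k ≢ q → f (fsuc k) ≡ g (fsuc k)
  tail-≗ k k≢q = f≗g (fsuc k) (λ e → k≢q (suc-injective e))

cruising-update : ∀ {N K} (T : Point N → Point N → ℚ) (P : ℚ) (R R' : Recommendation N K)
  (q : Fin K) (u v : Fin K → ℕ) (d : ℚ)
  → (∀ k → k ≢ q → R' k ≡ R k) → (∀ k → k ≢ q → u k ≡ v k)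
  → contribution T P (R' q) (u q) ≡ contribution T P (R q) (v q) + d
  → cruising T P R' u ≡ cruising T P R v + d
cruising-update T P R R' q u v d R'≗R u≗v =
  sumFin-update _ _ q d (λ k k≢q → cong₂ (contribution T P) (R'≗R k k≢q) (u≗v k k≢q))

decAt-≡ : ∀ {K} (q : Fin K) u → decAt q u q ≡ u q ∸ 1
decAt-≡ q u with q ≟ q
... | yes _   = refl
... | no q≢q = ⊥-elim (q≢q refl)

decAt-≢ : ∀ {K} (q : Fin K) u k → k ≢ q → decAt q u k ≡ u k
decAt-≢ q u k k≢q with k ≟ q
... | yes k≡q = ⊥-elim (k≢q k≡q)
... | no _    = refl

theorem2 : ∀ {N K : ℕ} (T : Point N → Point N → ℚ) (Penalty : ℚ)
    → (∀ a b → 0ℚ ≤ℚ T a b) → 0ℚ ≤ℚ Penalty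
    → (R R' : Recommendation N K)
    → (∀ k → Unique (R k)) → (∀ k → Unique (R' k))
    → (q : Fin K) (cs : List (Fin N)) (cl : Fin N)
    → R q ≡ cs → R' q ≡ cs ++ [ cl ]
    → (∀ k → k ≢ q → R' k ≡ R k)
    → (∀ k → k ≢ q → (i : Fin (length (R' k))) → lookup (R' k) i ≡ cl
         → (arrival T (R' k) (suc (toℕ i)) <ℚ arrival T (R' q) (suc (length cs)))
           ⊎ ((arrival T (R' k) (suc (toℕ i)) ≡ arrival T (R' q) (suc (length cs)))
              × toℕ k <ℕ toℕ q))
    → (u : Fin K → ℕ)
    → (∀ k → 1 ≤ u k × u k ≤ suc (length (R' k)))
    → ((u q <ℕ suc (length cs) → cruising T Penalty R' u ≡ cruising T Penalty R u)
       × (u q ≡ suc (length cs) → cruising T Penalty R' u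
            ≡ (cruising T Penalty R u - Penalty) + T (lastPoint cs) (fsuc cl))
       × (u q ≡ suc (suc (length cs)) → cruising T Penalty R' u
            ≡ cruising T Penalty R (decAt q u) + T (lastPoint cs) (fsuc cl)))
theorem2 T Penalty _ _ R R' _ _ q cs cl Rq≡cs R'q≡cs+cl R'≗R _ u _ = stopBefore , stopAtEnd , noStop
  where
  L = length cs
  t = T (lastPoint cs) (fsuc cl)
  C = contribution T Penalty

  compare : ∀ v d {i j} → (∀ k → k ≢ q → u k ≡ v k) → u q ≡ i → v q ≡ j
    → C (cs ++ [ cl ]) i ≡ C cs j + d → cruising T Penalty R' u ≡ cruising T Penalty R v + d
  compare v d u≗v refl refl eq = cruising-update T Penalty R R' q u v d R'≗R u≗v
    (subst₂ (λ r s → C r (u q) ≡ C s (v q) + d) (sym R'q≡cs+cl) (sym Rq≡cs) eq)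

  stopBefore : u q <ℕ suc L → cruising T Penalty R' u ≡ cruising T Penalty R u
  stopBefore (s≤s uq≤L) =
    trans (compare u 0ℚ (λ _ _ → refl) refl refl
             (trans (contribution-∷ʳ-≤ T Penalty cs cl (u q) uq≤L) (sym (+-identityʳ _))))
          (+-identityʳ _)

  stopAtEnd : u q ≡ suc L → cruising T Penalty R' u ≡ (cruising T Penalty R u - Penalty) + t
  stopAtEnd uq≡l = trans (compare u (t - Penalty) (λ _ _ → refl) uq≡l uq≡l (contribution-∷ʳ-last T Penalty cs cl))
    (solve 3 (λ S t P → S :+ (t :- P) := (S :- P) :+ t) refl (cruising T Penalty R u) t Penalty)

  noStop : u q ≡ suc (suc L) → cruising T Penalty R' u ≡ cruising T Penalty R (decAt q u) + t
  noStop uq≡l+1 = compare (decAt q u) t (λ k k≢q → sym (decAt-≢ q u k k≢q)) uq≡l+1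
    (trans (decAt-≡ q u) (cong (_∸ 1) uq≡l+1)) (contribution-∷ʳ-beyond T Penalty cs cl)
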